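{- Let $G$ be a tree-path intersection graph with the rooting and orders described in the context. If $s<_\ell s'$ and $\Gamma(s)\cap\Gamma(s')\neq\emptyset$, then $\min\Gamma(s')\in\Gamma(s)$ and $\min\Gamma(s)\le\min\Gamma(s')$.
   Context: A tree-path intersection graph is a connected bipartite graph $G$ with disjoint parts $G_H$, $G_V$, together with a tree $T_H$ on vertex set $G_H$ and a tree $T_V$ on vertex set $G_V$, such that for every $h\in G_H$ the neighbourhood $\Gamma(h)$ of $h$ in $G$ is the vertex set of a path in $T_V$, and for every $v\in G_V$ the neighbourhood $\Gamma(v)$ is the vertex set of a path in $T_H$. Fix an edge $h_{\mathrm{root}}v_{\mathrm{root}}\in E(G)$ such that $v_{\mathrm{root}}$ is a leaf of $T_V$; root $T_H$ at $h_{\mathrm{root}}$ and $T_V$ at $v_{\mathrm{root}}$. For $s_1,s_2$ both in $G_H$ (resp. both in $G_V$), $s_1\le s_2$ iff $s_1$ lies on the path of $T_H$ (resp. $T_V$) from the root to $s_2$; vertices from different sides are incomparable; $<$ is the strict version. $\min\Gamma(s)$ denotes the unique $\le$-minimal element of $\Gamma(s)$. Define $<_b$: for $s_1,s_2$ on the same side, $s_1<_b s_2$ iff $\min\Gamma(s_1)<\min\Gamma(s_2)$, or $\min\Gamma(s_1)=\min\Gamma(s_2)$ and $s_1<s_2$. Let $<_\ell$ be any relation that restricted to $G_H$ and to $G_V$ is a linear order extending $<_b$, with elements of different sides incomparable. -}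

module Defs where

open import Data.Nat using (ℕ; _≤_)
open import Data.Fin using (Fin)
open import Data.List using (List; []; _∷_; length)
open import Data.List.Membership.Propositional using (_∈_)
open import Data.List.Relation.Unary.Unique.Propositional using (Unique)
open import Data.Sum using (_⊎_; inj₁; inj₂)
open import Data.Product using (Σ; ∃; ∃₂; _×_; _,_)
open import Data.Empty using (⊥)
open import Relation.Binary.PropositionalEquality using (_≡_; _≢_)
open import Relation.Nullary using (¬_)

data Walk {V : Set} (Adj : V → V → Set) : V → V → Set where
  [_]    : ∀ v → Walk Adj v v
  _∷⟨_⟩_ : ∀ u {v w} → Adj u v → Walk Adj v w → Walk Adj u w

vertices : ∀ {V : Set} {Adj : V → V → Set} {u w} → Walk Adj u w → List V
vertices [ v ]          = v ∷ []
vertices (u ∷⟨ _ ⟩ p)   = u ∷ vertices p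

IsPath : ∀ {V : Set} {Adj : V → V → Set} {u w} → Walk Adj u w → Set
IsPath p = Unique (vertices p)

Connected : ∀ {V : Set} → (V → V → Set) → Set
Connected {V} Adj = ∀ (u w : V) → Walk Adj u w

record SimpleGraph (V : Set) : Set₁ where
  field
    Adj    : V → V → Set
    sym    : ∀ {u v} → Adj u v → Adj v u
    irrefl : ∀ {v} → ¬ Adj v v

open SimpleGraph public

HasCycle : ∀ {V : Set} → SimpleGraph V → Set
HasCycle {V} T = Σ V λ u → Σ V λ w → Σ (Walk (Adj T) u w) λ p →
  IsPath p × (3 ≤ length (vertices p)) × Adj T w u

record IsTree {V : Set} (T : SimpleGraph V) : Set where
  field
    connected : Connected (Adj T)
    acyclic   : ¬ HasCycle T

IsLeaf : ∀ {V : Set} → SimpleGraph V → V → Set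
IsLeaf T x = ∀ {u w} → Adj T x u → Adj T x w → u ≡ w

IsPathVertexSet : ∀ {V : Set} → SimpleGraph V → (V → Set) → Set
IsPathVertexSet {V} T P = Σ V λ u → Σ V λ w → Σ (Walk (Adj T) u w) λ p →
  IsPath p × (∀ x → (P x → x ∈ vertices p) × (x ∈ vertices p → P x))

-- Rooted-tree order: x ≤ y iff x lies on the path of T from root r to y.

Below : ∀ {V : Set} → SimpleGraph V → V → V → V → Set
Below T r x y = Σ (Walk (Adj T) r y) λ p → IsPath p × x ∈ vertices p

StrictBelow : ∀ {V : Set} → SimpleGraph V → V → V → V → Set
StrictBelow T r x y = Below T r x y × x ≢ y

-- x is a ≤-minimal element of P  (the "min P" of the paper, which is unique).
IsMinimal : ∀ {V : Set} → SimpleGraph V → V → (V → Set) → V → Set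
IsMinimal {V} T r P x = P x × (∀ y → P y → Below T r y x → y ≡ x)

BAdj : ∀ {m n} → (Fin m → Fin n → Set) → Fin m ⊎ Fin n → Fin m ⊎ Fin n → Set
BAdj E (inj₁ h) (inj₂ v) = E h v
BAdj E (inj₂ v) (inj₁ h) = E h v
BAdj E (inj₁ _) (inj₁ _) = ⊥
BAdj E (inj₂ _) (inj₂ _) = ⊥

record TPIG (m n : ℕ) : Set₁ where
  field
    E         : Fin m → Fin n → Set      -- edges h v of G, h ∈ G_H, v ∈ G_V
    TH        : SimpleGraph (Fin m)
    TV        : SimpleGraph (Fin n)
    TH-tree   : IsTree TH
    TV-tree   : IsTree TV
    connected : Connected (BAdj E)
    ΓH-path   : ∀ h → IsPathVertexSet TV (λ v → E h v)
    ΓV-path   : ∀ v → IsPathVertexSet TH (λ h → E h v)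

ΓH : ∀ {m n} → TPIG m n → Fin m → Fin n → Set
ΓH G h v = TPIG.E G h v

ΓV : ∀ {m n} → TPIG m n → Fin n → Fin m → Set
ΓV G v h = TPIG.E G h v

_⊢_<bH_ : ∀ {m n} → TPIG m n × Fin m × Fin n → Fin m → Fin m → Set
(G , hr , vr) ⊢ h₁ <bH h₂ = Σ _ λ a → Σ _ λ b →
  IsMinimal (TPIG.TV G) vr (ΓH G h₁) a × IsMinimal (TPIG.TV G) vr (ΓH G h₂) b ×
  (StrictBelow (TPIG.TV G) vr a b ⊎ (a ≡ b × StrictBelow (TPIG.TH G) hr h₁ h₂))

_⊢_<bV_ : ∀ {m n} → TPIG m n × Fin m × Fin n → Fin n → Fin n → Set
(G , hr , vr) ⊢ v₁ <bV v₂ = Σ _ λ a → Σ _ λ b →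
  IsMinimal (TPIG.TH G) hr (ΓV G v₁) a × IsMinimal (TPIG.TH G) hr (ΓV G v₂) b ×
  (StrictBelow (TPIG.TH G) hr a b ⊎ (a ≡ b × StrictBelow (TPIG.TV G) vr v₁ v₂))

{-# OPTIONS --safe #-}
-- The minimum a of the vertex set S of a path in a rooted tree is where every root path
-- into S enters it: for z ∈ S the path from the root to z passes through a and stays in S
-- after a.  For x ∈ Γ(s) ∩ Γ(s') the unique root path to x therefore passes through both
-- minima a and a'.  If a' came strictly before a, then a ∈ Γ(s') and min Γ(s') < min Γ(s),
-- so s' <_b s, contradicting s <_ℓ s'.  Hence a ≤ a', and a' lies on the part of the path
-- inside Γ(s).
module Submission where

open import Defs
open import Data.Fin using (Fin)
open import Data.Product using (Σ; _×_; _,_)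
open import Relation.Binary.PropositionalEquality using (_≡_)
open import Relation.Binary.Structures using (IsStrictTotalOrder)

open import Data.Fin.Properties using () renaming (_≟_ to _≟ᶠ_)
open import Data.Nat using (_≤_; z≤n; s≤s)
open import Data.Product using (proj₁; proj₂)
open import Data.List using (List; []; _∷_; length)
open import Data.List.Membership.Propositional using (_∈_)
open import Data.List.Relation.Binary.Subset.Propositional using (_⊆_)
open import Data.List.Relation.Unary.Any using (here; there)
open import Data.List.Relation.Unary.All as All using (All; []; _∷_)
open import Data.List.Relation.Unary.All.Properties using (anti-mono; ¬Any⇒All¬)
open import Data.List.Relation.Unary.AllPairs using ([]; _∷_)
open import Data.Sum as Sum using (_⊎_; inj₁; inj₂; [_,_]′)
open import Data.Empty using (⊥-elim)
open import Function using (_∘_; id)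
open import Relation.Nullary using (¬_; yes; no)
open import Relation.Unary using (Decidable)
open import Relation.Binary.Definitions using (Asymmetric; DecidableEquality)
open import Relation.Binary.PropositionalEquality as ≡ using (refl; subst; _≢_)

distinct⇒2≤length : ∀ {A : Set} {x y : A} {xs : List A} → x ∈ xs → y ∈ xs → x ≢ y → 2 ≤ length xs
distinct⇒2≤length {xs = _ ∷ _ ∷ _} _ _ _ = s≤s (s≤s z≤n)
distinct⇒2≤length {xs = _ ∷ []} (here refl) (here refl) x≢y = ⊥-elim (x≢y refl)
distinct⇒2≤length {xs = _ ∷ []} (there ()) _ _
distinct⇒2≤length {xs = _ ∷ []} _ (there ()) _

module WalkProperties {V : Set} (T : SimpleGraph V) where

  private
    variable
      u v w t : V

  infixr 5 _++ᵂ_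

  _++ᵂ_ : Walk (Adj T) u v → Walk (Adj T) v w → Walk (Adj T) u w
  [ _ ] ++ᵂ q = q
  (u ∷⟨ e ⟩ p) ++ᵂ q = u ∷⟨ e ⟩ (p ++ᵂ q)

  first∈ : (p : Walk (Adj T) u w) → u ∈ vertices p
  first∈ [ _ ] = here refl
  first∈ (_ ∷⟨ _ ⟩ _) = here refl

  last∈ : (p : Walk (Adj T) u w) → w ∈ vertices p
  last∈ [ _ ] = here refl
  last∈ (_ ∷⟨ _ ⟩ p) = there (last∈ p)

  ∈-++ᵂ⁺ˡ : (p : Walk (Adj T) u v) (q : Walk (Adj T) v w) → vertices p ⊆ vertices (p ++ᵂ q)
  ∈-++ᵂ⁺ˡ [ _ ] q (here refl) = first∈ q
  ∈-++ᵂ⁺ˡ [ _ ] q (there ())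
  ∈-++ᵂ⁺ˡ (_ ∷⟨ _ ⟩ p) q (here refl) = here refl
  ∈-++ᵂ⁺ˡ (_ ∷⟨ _ ⟩ p) q (there i) = there (∈-++ᵂ⁺ˡ p q i)

  ∈-++ᵂ⁺ʳ : (p : Walk (Adj T) u v) (q : Walk (Adj T) v w) → vertices q ⊆ vertices (p ++ᵂ q)
  ∈-++ᵂ⁺ʳ [ _ ] q i = i
  ∈-++ᵂ⁺ʳ (_ ∷⟨ _ ⟩ p) q i = there (∈-++ᵂ⁺ʳ p q i)

  ∈-++ᵂ⁻ : (p : Walk (Adj T) u v) (q : Walk (Adj T) v w) →
           t ∈ vertices (p ++ᵂ q) → t ∈ vertices p ⊎ t ∈ vertices q
  ∈-++ᵂ⁻ [ _ ] q i = inj₂ i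
  ∈-++ᵂ⁻ (_ ∷⟨ _ ⟩ p) q (here refl) = inj₁ (here refl)
  ∈-++ᵂ⁻ (_ ∷⟨ _ ⟩ p) q (there i) = Sum.map₁ there (∈-++ᵂ⁻ p q i)

  split : (p : Walk (Adj T) u w) → t ∈ vertices p →
          Σ (Walk (Adj T) u t) λ p₁ → Σ (Walk (Adj T) t w) λ p₂ → p ≡ p₁ ++ᵂ p₂
  split [ v ] (here refl) = [ v ] , [ v ] , refl
  split (u ∷⟨ e ⟩ p) (here refl) = [ u ] , u ∷⟨ e ⟩ p , refl
  split (u ∷⟨ e ⟩ p) (there i) with split p i
  ... | p₁ , p₂ , refl = u ∷⟨ e ⟩ p₁ , p₂ , refl

  prefix : (p : Walk (Adj T) u w) → t ∈ vertices p →
           Σ (Walk (Adj T) u t) λ p₁ → vertices p₁ ⊆ vertices p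
  prefix p t∈p with split p t∈p
  ... | p₁ , p₂ , refl = p₁ , ∈-++ᵂ⁺ˡ p₁ p₂

  IsPath-++ᵂ⁻ˡ : (p : Walk (Adj T) u v) (q : Walk (Adj T) v w) → IsPath (p ++ᵂ q) → IsPath p
  IsPath-++ᵂ⁻ˡ [ _ ] q _ = [] ∷ []
  IsPath-++ᵂ⁻ˡ (_ ∷⟨ _ ⟩ p) q (u∉p++q ∷ p++q-path) =
    anti-mono (∈-++ᵂ⁺ˡ p q) u∉p++q ∷ IsPath-++ᵂ⁻ˡ p q p++q-path

  IsPath-++ᵂ⁻ʳ : (p : Walk (Adj T) u v) (q : Walk (Adj T) v w) → IsPath (p ++ᵂ q) → IsPath q
  IsPath-++ᵂ⁻ʳ [ _ ] q p++q-path = p++q-path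
  IsPath-++ᵂ⁻ʳ (_ ∷⟨ _ ⟩ p) q (_ ∷ p++q-path) = IsPath-++ᵂ⁻ʳ p q p++q-path

  IsPath-++ᵂ⁺ : (p : Walk (Adj T) u v) (q : Walk (Adj T) v w) → IsPath p → IsPath q →
                (∀ {t} → t ∈ vertices p → t ∈ vertices q → t ≡ v) → IsPath (p ++ᵂ q)
  IsPath-++ᵂ⁺ [ _ ] q _ q-path _ = q-path
  IsPath-++ᵂ⁺ (u ∷⟨ _ ⟩ p) q (u∉p ∷ p-path) q-path p∩q⊆v =
    All.tabulate u∉ ∷ IsPath-++ᵂ⁺ p q p-path q-path (p∩q⊆v ∘ there)
    where
    u∉ : ∀ {t} → t ∈ vertices (p ++ᵂ q) → u ≢ t
    u∉ t∈p++q with ∈-++ᵂ⁻ p q t∈p++q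
    ... | inj₁ t∈p = All.lookup u∉p t∈p
    ... | inj₂ t∈q = λ { refl → All.lookup u∉p (last∈ p) (p∩q⊆v (here refl) t∈q) }

  IsPath-++ᵂ-junction : (p : Walk (Adj T) u v) (q : Walk (Adj T) v w) → IsPath (p ++ᵂ q) →
                        t ∈ vertices p → t ∈ vertices q → t ≡ v
  IsPath-++ᵂ-junction [ _ ] q _ (here refl) _ = refl
  IsPath-++ᵂ-junction [ _ ] q _ (there ()) _
  IsPath-++ᵂ-junction (_ ∷⟨ _ ⟩ p) q (u∉p++q ∷ _) (here refl) t∈q =
    ⊥-elim (All.lookup u∉p++q (∈-++ᵂ⁺ʳ p q t∈q) refl)
  IsPath-++ᵂ-junction (_ ∷⟨ _ ⟩ p) q (_ ∷ p++q-path) (there t∈p) t∈q =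
    IsPath-++ᵂ-junction p q p++q-path t∈p t∈q

  Below-prefix : ∀ {r} (p : Walk (Adj T) r v) (q : Walk (Adj T) v w) → IsPath (p ++ᵂ q) →
                 t ∈ vertices p → Below T r t v
  Below-prefix p q p++q-path t∈p = p , IsPath-++ᵂ⁻ˡ p q p++q-path , t∈p

  reverseᵂ : Walk (Adj T) u w → Walk (Adj T) w u
  reverseᵂ [ v ] = [ v ]
  reverseᵂ (u ∷⟨ e ⟩ p) = reverseᵂ p ++ᵂ (_ ∷⟨ sym T e ⟩ [ u ])

  ∈-reverseᵂ⁻ : (p : Walk (Adj T) u w) → vertices (reverseᵂ p) ⊆ vertices p
  ∈-reverseᵂ⁻ [ _ ] i = i
  ∈-reverseᵂ⁻ (_ ∷⟨ _ ⟩ p) i with ∈-++ᵂ⁻ (reverseᵂ p) _ i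
  ... | inj₁ j = there (∈-reverseᵂ⁻ p j)
  ... | inj₂ (here refl) = there (first∈ p)
  ... | inj₂ (there (here refl)) = here refl

  IsPath-reverseᵂ : (p : Walk (Adj T) u w) → IsPath p → IsPath (reverseᵂ p)
  IsPath-reverseᵂ [ _ ] p-path = p-path
  IsPath-reverseᵂ (_∷⟨_⟩_ u {v} e p) (u∉p ∷ p-path) =
    IsPath-++ᵂ⁺ (reverseᵂ p) back (IsPath-reverseᵂ p p-path) back-path meet
    where
    back : Walk (Adj T) v u
    back = v ∷⟨ sym T e ⟩ [ u ]
    back-path : IsPath back
    back-path = ((λ { refl → irrefl T e }) ∷ []) ∷ [] ∷ []
    meet : ∀ {t} → t ∈ vertices (reverseᵂ p) → t ∈ vertices back → t ≡ v
    meet _ (here refl) = refl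
    meet t∈p (there (here refl)) = ⊥-elim (All.lookup u∉p (∈-reverseᵂ⁻ p t∈p) refl)

module DecidableWalkProperties {V : Set} (_≟_ : DecidableEquality V) (T : SimpleGraph V) where

  open WalkProperties T
  open import Data.List.Membership.DecPropositional _≟_ using (_∈?_)

  private
    variable
      u w y z : V

  shorten : (q : Walk (Adj T) u w) → Σ (Walk (Adj T) u w) λ p → IsPath p × vertices p ⊆ vertices q
  shorten [ v ] = [ v ] , [] ∷ [] , id
  shorten (u ∷⟨ e ⟩ q) with shorten q
  ... | p , p-path , p⊆q with u ∈? vertices p
  ...   | no u∉p = u ∷⟨ e ⟩ p , ¬Any⇒All¬ _ u∉p ∷ p-path ,
                   λ { (here refl) → here refl ; (there i) → there (p⊆q i) }
  ...   | yes u∈p with split p u∈p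
  ...     | p₁ , p₂ , refl = p₂ , IsPath-++ᵂ⁻ʳ p₁ p₂ p-path , there ∘ p⊆q ∘ ∈-++ᵂ⁺ʳ p₁ p₂

  first-hit : ∀ {P : V → Set} → Decidable P → (p : Walk (Adj T) u w) → P w →
    Σ V λ y → Σ (Walk (Adj T) u y) λ p₁ → Σ (Walk (Adj T) y w) λ p₂ →
    p ≡ p₁ ++ᵂ p₂ × P y × (∀ {t} → t ∈ vertices p₁ → P t → t ≡ y)
  first-hit P? [ v ] Pv = v , [ v ] , [ v ] , refl , Pv , λ { (here refl) _ → refl ; (there ()) }
  first-hit P? (u ∷⟨ e ⟩ p) Pw with P? u
  ... | yes Pu = u , [ u ] , u ∷⟨ e ⟩ p , refl , Pu , λ { (here refl) _ → refl ; (there ()) }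
  ... | no ¬Pu with first-hit P? p Pw
  ...   | y , p₁ , p₂ , refl , Py , p₁∩P⊆y =
    y , u ∷⟨ e ⟩ p₁ , p₂ , refl , Py , λ { (here refl) Pu → ⊥-elim (¬Pu Pu) ; (there i) → p₁∩P⊆y i }

  path-within : (P : Walk (Adj T) u w) → y ∈ vertices P → z ∈ vertices P →
                Σ (Walk (Adj T) y z) λ σ → IsPath σ × vertices σ ⊆ vertices P
  path-within P y∈P z∈P with prefix P y∈P | prefix P z∈P
  ... | P₁ , P₁⊆P | Q₁ , Q₁⊆P with shorten (reverseᵂ P₁ ++ᵂ Q₁)
  ... | σ , σ-path , σ⊆ =
    σ , σ-path , [ P₁⊆P ∘ ∈-reverseᵂ⁻ P₁ , Q₁⊆P ]′ ∘ ∈-++ᵂ⁻ (reverseᵂ P₁) Q₁ ∘ σ⊆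

module AcyclicProperties {V : Set} (_≟_ : DecidableEquality V) {T : SimpleGraph V}
                         (acyclic : ¬ HasCycle T) where

  open WalkProperties T
  open DecidableWalkProperties _≟_ T
  open import Data.List.Membership.DecPropositional _≟_ using (_∈?_)

  private
    variable
      u u₁ u₂ w : V

  fork⇒HasCycle : Adj T u u₁ → Adj T u u₂ → u₁ ≢ u₂ →
    (p : Walk (Adj T) u₁ w) (q : Walk (Adj T) u₂ w) → IsPath p → IsPath q →
    All (u ≢_) (vertices p) → All (u ≢_) (vertices q) → HasCycle T
  -- With z the first vertex of p on q, the cycle is u → u₁ ⋯ z ⋯ u₂ → u (p up to z, then q backwards).
  fork⇒HasCycle {u = u} e f u₁≢u₂ p q p-path q-path u∉p u∉q
    with first-hit (_∈? vertices q) p (last∈ q)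
  ... | z , p₁ , p₂ , refl , z∈q , p₁∩q⊆z with split q z∈q
  ... | q₁ , q₂ , refl =
    u , _ , u ∷⟨ e ⟩ arc , u∉arc ∷ arc-path ,
    s≤s (distinct⇒2≤length (∈-++ᵂ⁺ˡ p₁ _ (first∈ p₁)) (∈-++ᵂ⁺ʳ p₁ _ (last∈ (reverseᵂ q₁))) u₁≢u₂) ,
    sym T f
    where
    arc = p₁ ++ᵂ reverseᵂ q₁
    arc-path : IsPath arc
    arc-path = IsPath-++ᵂ⁺ p₁ (reverseᵂ q₁) (IsPath-++ᵂ⁻ˡ p₁ p₂ p-path)
      (IsPath-reverseᵂ q₁ (IsPath-++ᵂ⁻ˡ q₁ q₂ q-path))
      (λ i j → p₁∩q⊆z i (∈-++ᵂ⁺ˡ q₁ q₂ (∈-reverseᵂ⁻ q₁ j)))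
    u∉arc : All (u ≢_) (vertices arc)
    u∉arc = All.tabulate ([ All.lookup u∉p ∘ ∈-++ᵂ⁺ˡ p₁ p₂
                          , All.lookup u∉q ∘ ∈-++ᵂ⁺ˡ q₁ q₂ ∘ ∈-reverseᵂ⁻ q₁ ]′
                          ∘ ∈-++ᵂ⁻ p₁ (reverseᵂ q₁))

  acyclic-path-⊆ : (p q : Walk (Adj T) u w) → IsPath p → IsPath q → vertices p ⊆ vertices q
  acyclic-path-⊆ [ _ ] q _ _ (here refl) = first∈ q
  acyclic-path-⊆ [ _ ] q _ _ (there ())
  acyclic-path-⊆ (_ ∷⟨ _ ⟩ p) [ _ ] (u∉p ∷ _) _ _ = ⊥-elim (All.lookup u∉p (last∈ p) refl)
  acyclic-path-⊆ (_∷⟨_⟩_ _ {u₁} e p) (_∷⟨_⟩_ _ {u₂} f q) (u∉p ∷ p-path) (u∉q ∷ q-path)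
    with u₁ ≟ u₂
  ... | no u₁≢u₂ = ⊥-elim (acyclic (fork⇒HasCycle e f u₁≢u₂ p q p-path q-path u∉p u∉q))
  ... | yes refl = λ { (here refl) → here refl
                     ; (there i) → there (acyclic-path-⊆ p q p-path q-path i) }

  Below-antisym : ∀ {r x y} → Below T r x y → Below T r y x → x ≡ y
  Below-antisym (p , p-path , x∈p) (q , q-path , y∈q) with split q y∈q
  ... | q₁ , q₂ , refl =
    IsPath-++ᵂ-junction q₁ q₂ q-path
      (acyclic-path-⊆ p q₁ p-path (IsPath-++ᵂ⁻ˡ q₁ q₂ q-path) x∈p) (last∈ q₂)

module RootedTreeProperties {V : Set} (_≟_ : DecidableEquality V) {T : SimpleGraph V}
                            (tree : IsTree T) (r : V) where

  open WalkProperties T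
  open DecidableWalkProperties _≟_ T
  open AcyclicProperties _≟_ {T} (IsTree.acyclic tree)
  open import Data.List.Membership.DecPropositional _≟_ using (_∈?_)

  record RootPathVia (S : V → Set) (a z : V) : Set where
    constructor via
    field
      toVia      : Walk (Adj T) r a
      fromVia    : Walk (Adj T) a z
      isPath     : IsPath (toVia ++ᵂ fromVia)
      fromVia⊆S  : ∀ {t} → t ∈ vertices fromVia → S t

  RootPathVia⇒Below : ∀ {S a z} → RootPathVia S a z → Below T r a z
  RootPathVia⇒Below (via π σ πσ-path _) = π ++ᵂ σ , πσ-path , ∈-++ᵂ⁺ˡ π σ (last∈ π)

  minimal-entry : ∀ {S a z} → IsPathVertexSet T S → IsMinimal T r S a → S z → RootPathVia S a z
  minimal-entry {S} {a} {z} (_ , _ , P , _ , S⇔P) (Sa , a-min) Sz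
    with shorten (IsTree.connected tree r a)
  ... | π , π-path , _ with first-hit (_∈? vertices P) π (proj₁ (S⇔P a) Sa)
  ... | y , π₁ , π₂ , refl , y∈P , π₁∩P⊆y = subst (λ b → RootPathVia S b z) y≡a (via-y Sz)
    -- y is where the root path to a first meets S; the rest of S hangs off y inside S,
    -- so y ≤ a and minimality forces y = a.
    where
    via-y : ∀ {z} → S z → RootPathVia S y z
    via-y {z} Sz with path-within P y∈P (proj₁ (S⇔P z) Sz)
    ... | σ , σ-path , σ⊆P =
      via π₁ σ (IsPath-++ᵂ⁺ π₁ σ (IsPath-++ᵂ⁻ˡ π₁ π₂ π-path) σ-path (λ i j → π₁∩P⊆y i (σ⊆P j)))
              (proj₂ (S⇔P _) ∘ σ⊆P)
    y≡a : y ≡ a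
    y≡a = a-min y (proj₂ (S⇔P y) y∈P) (RootPathVia⇒Below (via-y Sa))

  minima-ordered : {I : Set} (Γ : I → V → Set) → (∀ i → IsPathVertexSet T (Γ i)) →
    (_<_ : I → I → Set) → Asymmetric _<_ →
    (∀ s s' a a' → IsMinimal T r (Γ s) a → IsMinimal T r (Γ s') a' → StrictBelow T r a a' → s < s') →
    ∀ s s' → s < s' → Σ V (λ x → Γ s x × Γ s' x) →
    ∀ a a' → IsMinimal T r (Γ s) a → IsMinimal T r (Γ s') a' → Γ s a' × Below T r a a'
  minima-ordered Γ Γ-path _ <-asym minima-< s s' s<s' (_ , Γsx , Γs'x) a a' a-min a'-min
    with minimal-entry (Γ-path s) a-min Γsx | minimal-entry (Γ-path s') a'-min Γs'x
  ... | via π σ πσ-path σ⊆Γs | via π' σ' π'σ'-path σ'⊆Γs'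
    with ∈-++ᵂ⁻ π' σ' (acyclic-path-⊆ _ _ πσ-path π'σ'-path (∈-++ᵂ⁺ʳ π σ (first∈ σ)))
       | ∈-++ᵂ⁻ π σ (acyclic-path-⊆ _ _ π'σ'-path πσ-path (∈-++ᵂ⁺ʳ π' σ' (first∈ σ')))
  ... | inj₁ a∈π' | inj₁ a'∈π =
    subst (Γ s) (Below-antisym (Below-prefix π' σ' π'σ'-path a∈π') (Below-prefix π σ πσ-path a'∈π))
          (proj₁ a-min)
    , Below-prefix π' σ' π'σ'-path a∈π'
  ... | inj₁ a∈π' | inj₂ a'∈σ = σ⊆Γs a'∈σ , Below-prefix π' σ' π'σ'-path a∈π'
  ... | inj₂ a∈σ' | _ with a ≟ a'
  ...   | yes refl = proj₁ a-min , Below-prefix π σ πσ-path (last∈ π)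
  ...   | no a≢a' = ⊥-elim (<-asym s<s' (minima-< s' s a' a a'-min a-min (a'≤a , a≢a' ∘ ≡.sym)))
    where
    a'≤a = RootPathVia⇒Below (minimal-entry (Γ-path s') a'-min (σ'⊆Γs' a∈σ'))

lemma16 : ∀ {m n} (G : TPIG m n) (hr : Fin m) (vr : Fin n) →
    TPIG.E G hr vr → IsLeaf (TPIG.TV G) vr →
    (_<ℓH_ : Fin m → Fin m → Set) (_<ℓV_ : Fin n → Fin n → Set) →
    IsStrictTotalOrder _≡_ _<ℓH_ → IsStrictTotalOrder _≡_ _<ℓV_ →
    (∀ a b → (G , hr , vr) ⊢ a <bH b → a <ℓH b) →
    (∀ a b → (G , hr , vr) ⊢ a <bV b → a <ℓV b) →
    (∀ s s' → s <ℓH s' → Σ (Fin n) (λ x → ΓH G s x × ΓH G s' x) →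
      ∀ a a' → IsMinimal (TPIG.TV G) vr (ΓH G s) a → IsMinimal (TPIG.TV G) vr (ΓH G s') a' →
      ΓH G s a' × Below (TPIG.TV G) vr a a')
    ×
    (∀ s s' → s <ℓV s' → Σ (Fin m) (λ x → ΓV G s x × ΓV G s' x) →
      ∀ a a' → IsMinimal (TPIG.TH G) hr (ΓV G s) a → IsMinimal (TPIG.TH G) hr (ΓV G s') a' →
      ΓV G s a' × Below (TPIG.TH G) hr a a')
lemma16 G hr vr _ _ _<ℓH_ _<ℓV_ <ℓH-strict <ℓV-strict <bH⇒<ℓH <bV⇒<ℓV =
  RootedTreeTV.minima-ordered (ΓH G) (TPIG.ΓH-path G) _<ℓH_ (IsStrictTotalOrder.asym <ℓH-strict)
    (λ s s' a a' a-min a'-min a<a' → <bH⇒<ℓH s s' (a , a' , a-min , a'-min , inj₁ a<a'))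
  ,
  RootedTreeTH.minima-ordered (ΓV G) (TPIG.ΓV-path G) _<ℓV_ (IsStrictTotalOrder.asym <ℓV-strict)
    (λ s s' a a' a-min a'-min a<a' → <bV⇒<ℓV s s' (a , a' , a-min , a'-min , inj₁ a<a'))
  where
  module RootedTreeTV = RootedTreeProperties _≟ᶠ_ (TPIG.TV-tree G) vr
  module RootedTreeTH = RootedTreeProperties _≟ᶠ_ (TPIG.TH-tree G) hr
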